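{- For finite sets $S, X\subset\mathbb{Z}^2$ with $(0,0)\in S$ and $S\cap X=\emptyset$, let $N_{S,X}(n)$ be the number of edge-connected sets $P\subset\mathbb{Z}^2$ with $|P|=n$, $S\subseteq P$ and $P\cap X=\emptyset$. Define, with $S=\{(0,0)\}$ in all cases, \begin{align*} E(n)&=N_{S,X_E}(n),& X_E&=\{(-1,0),(1,0),(-1,-1),(0,-1),(1,-1)\},\\ F(n)&=N_{S,X_F}(n),& X_F&=\{(-1,-1),(0,-1),(1,-1)\},\\ G(n)&=N_{S,X_G}(n),& X_G&=\{(-1,0),(-1,-1),(0,-1),(1,-1)\},\\ H(n)&=N_{S,X_H}(n),& X_H&=\{(-1,1),(-1,0),(-1,-1),(0,-1),(1,-1)\},\\ L(n)&=N_{S,X_L}(n),& X_L&=\{(-1,0),(-1,-1),(0,-1),(1,-1),(2,-1)\},\\ M(n)&=N_{S,X_M}(n),& X_M&=\{(-1,1),(-1,0),(-1,-1),(0,-1),(1,-1),(2,-1)\}, \end{align*} for $n\ge 1$, and set all of these to $0$ for $n\le 0$. Then for all $n\ge 2$, \begin{align*} E(n) &\le F(n-1), \\ F(n) &\le G(n) + \sum_{i+j=n} G(i) H(j), \\ G(n) &\le F(n-1)+G(n-1)+\sum_{i+j=n-1} G(i) L(j), \\ H(n) &\le 2G(n-1)+ \sum_{i+j=n-1} E(i) L(j), \\ L(n) &\le F(n-1)+H(n-1)+ \sum_{i+j=n-1} G(i) M(j), \\ M(n) &\le G(n-1)+H(n-1)+ \sum_{i+j=n-1} E(i) M(j), \end{align*}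 where each sum $\sum_{i+j=m}$ runs over integers $i,j\ge 1$ with $i+j=m$.
   Context: Points of $\mathbb{Z}^2$ are cells $(a,b)$, with $a$ the horizontal coordinate (increasing to the right) and $b$ the vertical coordinate (increasing upward); two cells are edge-adjacent if they differ by $1$ in exactly one coordinate, and a set is edge-connected if its adjacency graph is connected. Equivalently, $N_{S,X}(n)$ counts pairs $(P,c)$ of a polyomino $P$ with $n$ cells (up to translation) and a cell $c\in P$ such that, placing $c$ at the origin, $P$ contains the positions of $S$ and none of the positions of $X$. -}

module Defs where

open import Data.Nat using (ℕ; zero; suc; _+_; _*_; _∸_)
open import Data.Integer as ℤ using (ℤ; +_; -[1+_]; ∣_∣; _-_)
open import Data.Product using (Σ; ∃; _×_; _,_)
open import Data.Sum using (_⊎_)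
open import Data.Fin using (Fin)
open import Data.List using (List; []; _∷_; length; map; upTo)
open import Data.Nat.ListAction using (sum)
open import Data.List.Membership.Propositional using (_∈_; _∉_)
open import Data.List.Relation.Unary.All using (All)
open import Data.List.Relation.Unary.Unique.Propositional using (Unique)
open import Relation.Binary.PropositionalEquality using (_≡_)

Cell : Set
Cell = ℤ × ℤ

Adj : Cell → Cell → Set
Adj (a , b) (c , d) = (a ≡ c × ∣ b - d ∣ ≡ 1) ⊎ (b ≡ d × ∣ a - c ∣ ≡ 1)

-- A finite set of cells is represented by a duplicate-free list;
-- walks inside the set along adjacent cells.
data Walk (P : List Cell) : Cell → Cell → Set where
  here : ∀ {x} → x ∈ P → Walk P x x
  step : ∀ {x y z} → x ∈ P → Adj x y → Walk P y z → Walk P x z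

EdgeConnected : List Cell → Set
EdgeConnected P = ∀ {x y} → x ∈ P → y ∈ P → Walk P x y

SameSet : List Cell → List Cell → Set
SameSet P Q = ∀ x → (x ∈ P → x ∈ Q) × (x ∈ Q → x ∈ P)

Admissible : List Cell → List Cell → ℕ → List Cell → Set
Admissible S X n P =
  Unique P × length P ≡ n × EdgeConnected P × All (_∈ P) S × All (_∉ P) X

IsCount : List Cell → List Cell → ℕ → ℕ → Set
IsCount S X n k =
  Σ (Fin k → List Cell) λ ps →
    (∀ i → Admissible S X n (ps i)) ×
    (∀ i j → SameSet (ps i) (ps j) → i ≡ j) ×
    (∀ P → Admissible S X n P → ∃ λ i → SameSet P (ps i))

-- conv f g m = Σ_{i,j ≥ 1, i + j = m} f i * g j
conv : (ℕ → ℕ) → (ℕ → ℕ) → ℕ → ℕ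
conv f g m = sum (map (λ k → f (suc k) * g (m ∸ suc k)) (upTo (m ∸ 1)))

z0 z1 z2 m1 : ℤ
z0 = + 0
z1 = + 1
z2 = + 2
m1 = -[1+ 0 ]

S₀ : List Cell
S₀ = (z0 , z0) ∷ []

X-E X-F X-G X-H X-L X-M : List Cell
X-E = (m1 , z0) ∷ (z1 , z0) ∷ (m1 , m1) ∷ (z0 , m1) ∷ (z1 , m1) ∷ []
X-F = (m1 , m1) ∷ (z0 , m1) ∷ (z1 , m1) ∷ []
X-G = (m1 , z0) ∷ (m1 , m1) ∷ (z0 , m1) ∷ (z1 , m1) ∷ []
X-H = (m1 , z1) ∷ (m1 , z0) ∷ (m1 , m1) ∷ (z0 , m1) ∷ (z1 , m1) ∷ []
X-L = (m1 , z0) ∷ (m1 , m1) ∷ (z0 , m1) ∷ (z1 , m1) ∷ (z2 , m1) ∷ []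
X-M = (m1 , z1) ∷ (m1 , z0) ∷ (m1 , m1) ∷ (z0 , m1) ∷ (z1 , m1) ∷ (z2 , m1) ∷ []

{-# OPTIONS --safe #-}
-- Each bound comes from an injective decomposition of the polyominoes P counted on the left.
-- If the origin has a single neighbour c in P (always for E; for G, H, L, M when only one
-- of north and east is present), deleting the origin leaves a polyomino with n - 1 cells,
-- which a lattice symmetry sending c to the origin makes admissible for the first or the
-- second term. If north and east are both present, delete the origin and cut along north
-- and north²: the component of east and the rest are polyominoes, and symmetries sending
-- east and north to the origin make them admissible for the two factors of the convolution.
-- For F, P is counted by G unless west is present, in which case west's component after
-- removing origin and north is split off, leaving a polyomino that contains the origin.
-- Since P is recovered from its pieces, the enumerations given by the counts on the right
-- cover all P, whence the inequality. The forbidden cells of each piece are checked by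
-- evaluation: pulled back, each one is forbidden for P or provably absent from the piece.
module Submission where

open import Defs
open import Data.Nat using (ℕ; _+_; _*_; _∸_; _≤_)
open import Data.Product using (_×_)

open import Data.Nat using (zero; suc; s≤s; _<_)
import Data.Nat.Properties as ℕ
open import Data.Nat.ListAction using (sum)
open import Data.Integer as ℤ using (∣_∣; _-_)
import Data.Integer.Properties as ℤ
open import Data.Integer.Solver using (module +-*-Solver)
open import Data.Fin using (Fin; splitAt; _↑ˡ_; _↑ʳ_; combine; remQuot)
import Data.Fin.Properties as Fin
open import Data.Product using (∃; ∃₂; _,_; proj₁; proj₂; swap)
open import Data.Product.Properties using (≡-dec)
open import Data.Sum using (_⊎_; inj₁; inj₂; [_,_]′)
import Data.Sum as Sum
open import Data.Empty using (⊥-elim)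
open import Function using (_∘_; case_of_)
open import Data.List using (List; []; _∷_; [_]; _++_; length; map; filter; upTo)
import Data.List.Properties as List
open import Data.List.Membership.Propositional using (_∈_; _∉_; find; lose)
open import Data.List.Membership.Propositional.Properties
  using (∈-filter⁺; ∈-filter⁻; ∈-map⁺; ∈-map⁻; ∈-++⁺ˡ; ∈-++⁺ʳ; ∈-++⁻; ∈-upTo⁺; ∈-length)
open import Data.List.Relation.Binary.Subset.Propositional using (_⊆_)
open import Data.List.Relation.Unary.Any as Any using (here; there; any?)
open import Data.List.Relation.Unary.All as All using (All; []; _∷_)
open import Data.List.Relation.Unary.All.Properties using (++⁺)
open import Data.List.Relation.Unary.Unique.Propositional using (Unique)
import Data.List.Relation.Unary.Unique.Propositional.Properties as Unique
import Data.List.Relation.Unary.AllPairs as AllPairs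
open import Relation.Binary.PropositionalEquality hiding ([_])
open import Relation.Binary.Definitions using (DecidableEquality)
open import Relation.Nullary using (Dec; yes; no)
open import Relation.Nullary.Decidable using (_×-dec_; _⊎-dec_; True; toWitness)
open import Relation.Unary using (Decidable)
open import Relation.Unary.Properties using (∁?)

_≟ᶜ_ : DecidableEquality Cell
_≟ᶜ_ = ≡-dec ℤ._≟_ ℤ._≟_

open import Data.List.Membership.DecPropositional _≟ᶜ_ using (_∈?_; _∉?_)
open import Data.List.Relation.Binary.Subset.DecPropositional _≟ᶜ_ using (_⊆?_)

decide-⊆ : ∀ {xs ys : List Cell} → True (xs ⊆? ys) → xs ⊆ ys
decide-⊆ = toWitness

origin north north² east west south northeast northwest : Cell
origin    = z0 , z0
north     = z0 , z1
north²    = z0 , z2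
east      = z1 , z0
west      = m1 , z0
south     = z0 , m1
northeast = z1 , z1
northwest = m1 , z1

Adj? : ∀ x y → Dec (Adj x y)
Adj? (a , b) (c , d) =
  ((a ℤ.≟ c) ×-dec (∣ b - d ∣ ℕ.≟ 1)) ⊎-dec ((b ℤ.≟ d) ×-dec (∣ a - c ∣ ℕ.≟ 1))

Adj-sym : ∀ {x y} → Adj x y → Adj y x
Adj-sym {a , b} {c , d} (inj₁ (a≡c , ∣b-d∣≡1)) = inj₁ (sym a≡c , trans (ℤ.∣i-j∣≡∣j-i∣ d b) ∣b-d∣≡1)
Adj-sym {a , b} {c , d} (inj₂ (b≡d , ∣a-c∣≡1)) = inj₂ (sym b≡d , trans (ℤ.∣i-j∣≡∣j-i∣ c a) ∣a-c∣≡1)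

∣i-0∣≡1⇒i≡±1 : ∀ i → ∣ i - z0 ∣ ≡ 1 → i ≡ z1 ⊎ i ≡ m1
∣i-0∣≡1⇒i≡±1 (ℤ.+ 0)           ()
∣i-0∣≡1⇒i≡±1 (ℤ.+ 1)           _ = inj₁ refl
∣i-0∣≡1⇒i≡±1 (ℤ.+ suc (suc _)) ()
∣i-0∣≡1⇒i≡±1 ℤ.-[1+ 0 ]        _ = inj₂ refl
∣i-0∣≡1⇒i≡±1 ℤ.-[1+ suc _ ]    ()

corner-neighbour : ∀ {P y} → west ∉ P → south ∉ P → y ∈ P → Adj y origin → y ≡ north ⊎ y ≡ east
corner-neighbour {y = c , d} west∉P south∉P y∈P (inj₁ (refl , ∣d∣≡1)) with ∣i-0∣≡1⇒i≡±1 d ∣d∣≡1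
... | inj₁ refl = inj₁ refl
... | inj₂ refl = ⊥-elim (south∉P y∈P)
corner-neighbour {y = c , d} west∉P south∉P y∈P (inj₂ (refl , ∣c∣≡1)) with ∣i-0∣≡1⇒i≡±1 c ∣c∣≡1
... | inj₁ refl = inj₂ refl
... | inj₂ refl = ⊥-elim (west∉P y∈P)

SameSet-refl : ∀ {P} → SameSet P P
SameSet-refl _ = (λ x∈P → x∈P) , (λ x∈P → x∈P)

SameSet-sym : ∀ {P Q} → SameSet P Q → SameSet Q P
SameSet-sym P≈Q x = proj₂ (P≈Q x) , proj₁ (P≈Q x)

SameSet-trans : ∀ {P Q R} → SameSet P Q → SameSet Q R → SameSet P R
SameSet-trans P≈Q Q≈R x =
  (λ x∈P → proj₁ (Q≈R x) (proj₁ (P≈Q x) x∈P)) , (λ x∈R → proj₂ (P≈Q x) (proj₂ (Q≈R x) x∈R))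

SameSet-split : ∀ {P A B} → (∀ {x} → x ∈ P → x ∈ A ⊎ x ∈ B) → A ⊆ P → B ⊆ P → SameSet P (A ++ B)
SameSet-split {A = A} split A⊆P B⊆P x = [ ∈-++⁺ˡ , ∈-++⁺ʳ A ]′ ∘ split , [ A⊆P , B⊆P ]′ ∘ ∈-++⁻ A

SameSet-++ : ∀ {A A′ B B′} → SameSet A A′ → SameSet B B′ → SameSet (A ++ B) (A′ ++ B′)
SameSet-++ {A} {A′} {B} {B′} A≈A′ B≈B′ = SameSet-split
  (Sum.map (proj₁ (A≈A′ _)) (proj₁ (B≈B′ _)) ∘ ∈-++⁻ A)
  (∈-++⁺ˡ ∘ proj₂ (A≈A′ _))
  (∈-++⁺ʳ A ∘ proj₂ (B≈B′ _))

length-filter-∁ : ∀ {A : Set} {P : A → Set} (P? : Decidable P) xs →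
  length (filter P? xs) + length (filter (∁? P?) xs) ≡ length xs
length-filter-∁ P? []       = refl
length-filter-∁ P? (x ∷ xs) with P? x
... | yes _ = cong suc (length-filter-∁ P? xs)
... | no  _ = trans (ℕ.+-suc _ _) (cong suc (length-filter-∁ P? xs))

avoid-⊆ : ∀ {A P Y : List Cell} → A ⊆ P → All (_∉ P) Y → All (_∉ A) Y
avoid-⊆ A⊆P = All.map (λ y∉P → y∉P ∘ A⊆P)

_∖_ : List Cell → List Cell → List Cell
xs ∖ ys = filter (_∉? ys) xs

∈-∖⁺ : ∀ {x xs ys} → x ∈ xs → x ∉ ys → x ∈ xs ∖ ys
∈-∖⁺ {ys = ys} = ∈-filter⁺ (_∉? ys)

∈-∖⁻ : ∀ {x xs ys} → x ∈ xs ∖ ys → x ∈ xs × x ∉ ys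
∈-∖⁻ {ys = ys} = ∈-filter⁻ (_∉? ys)

∈-∖-single⁺ : ∀ {x y xs} → x ∈ xs → x ≢ y → x ∈ xs ∖ [ y ]
∈-∖-single⁺ x∈xs x≢y = ∈-∖⁺ x∈xs λ { (here x≡y) → x≢y x≡y }

∉-∖ : ∀ {x xs ys} → x ∈ ys → x ∉ xs ∖ ys
∉-∖ {xs = xs} x∈ys x∈xs∖ys = proj₂ (∈-∖⁻ {xs = xs} x∈xs∖ys) x∈ys

∖-⊆ : ∀ {xs ys} → xs ∖ ys ⊆ xs
∖-⊆ = proj₁ ∘ ∈-∖⁻

Unique-∖ : ∀ {xs ys} → Unique xs → Unique (xs ∖ ys)
Unique-∖ {ys = ys} = Unique.filter⁺ (_∉? ys)

length-∖-single : ∀ {x xs} → Unique xs → x ∈ xs → suc (length (xs ∖ [ x ])) ≡ length xs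
length-∖-single {x} {y ∷ ys} _ _ with y ≟ᶜ x
length-∖-single {x} (y∉ys AllPairs.∷ _) (here refl) | yes _ =
  cong (suc ∘ length) (List.filter-all (_∉? [ x ]) (All.map (λ { y≢x (here refl) → y≢x refl }) y∉ys))
length-∖-single (y∉ys AllPairs.∷ _)         (there x∈ys) | yes refl = ⊥-elim (All.lookup y∉ys x∈ys refl)
length-∖-single _                           (here refl)  | no y≢x   = ⊥-elim (y≢x refl)
length-∖-single (_ AllPairs.∷ ys-unique)    (there x∈ys) | no _     =
  cong suc (length-∖-single ys-unique x∈ys)

length-∖-< : ∀ {x xs} → x ∈ xs → length (xs ∖ [ x ]) < length xs
length-∖-< {x} {xs} x∈xs =
  List.filter-notAll (_∉? [ x ]) xs (Any.map (λ { refl x∉[x] → x∉[x] (here refl) }) x∈xs)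

SameSet-∖-single : ∀ {x xs} → x ∈ xs → SameSet xs (x ∷ xs ∖ [ x ])
SameSet-∖-single {x} {xs} x∈xs = SameSet-split split (λ { (here refl) → x∈xs }) ∖-⊆
  where
  split : ∀ {y} → y ∈ xs → y ∈ [ x ] ⊎ y ∈ xs ∖ [ x ]
  split {y} y∈xs with y ≟ᶜ x
  ... | yes y≡x = inj₁ (here y≡x)
  ... | no  y≢x = inj₂ (∈-∖-single⁺ y∈xs y≢x)

Walk-source : ∀ {P x y} → Walk P x y → x ∈ P
Walk-source (here x∈P)     = x∈P
Walk-source (step x∈P _ _) = x∈P

Walk-target : ∀ {P x y} → Walk P x y → y ∈ P
Walk-target (here y∈P)   = y∈P
Walk-target (step _ _ w) = Walk-target w

Walk-snoc : ∀ {P x y z} → Walk P x y → Adj y z → z ∈ P → Walk P x z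
Walk-snoc (here y∈P)       y~z z∈P = step y∈P y~z (here z∈P)
Walk-snoc (step x∈P x~u w) y~z z∈P = step x∈P x~u (Walk-snoc w y~z z∈P)

Walk-reverse : ∀ {P x y} → Walk P x y → Walk P y x
Walk-reverse (here x∈P)       = here x∈P
Walk-reverse (step x∈P x~u w) = Walk-snoc (Walk-reverse w) (Adj-sym x~u) x∈P

_++ʷ_ : ∀ {P x y z} → Walk P x y → Walk P y z → Walk P x z
here _         ++ʷ w′ = w′
step x∈P x~u w ++ʷ w′ = step x∈P x~u (w ++ʷ w′)

Walk-mono : ∀ {P Q x y} → P ⊆ Q → Walk P x y → Walk Q x y
Walk-mono P⊆Q (here x∈P)       = here (P⊆Q x∈P)
Walk-mono P⊆Q (step x∈P x~u w) = step (P⊆Q x∈P) x~u (Walk-mono P⊆Q w)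

rooted⇒EdgeConnected : ∀ {P} r → (∀ {x} → x ∈ P → Walk P x r) → EdgeConnected P
rooted⇒EdgeConnected r walk-to-r x∈P y∈P = walk-to-r x∈P ++ʷ Walk-reverse (walk-to-r y∈P)

Walk-restrict : ∀ {P R r} →
  (∀ {y z} → y ∈ R → z ∈ P → z ∉ R → Adj y z → Walk R y r) →
  ∀ {x} → x ∈ R → Walk P x r → Walk R x r
Walk-restrict exit x∈R (here _) = here x∈R
Walk-restrict {R = R} exit x∈R (step {y = u} _ x~u w) with u ∈? R
... | yes u∈R = step x∈R x~u (Walk-restrict exit u∈R w)
... | no  u∉R = exit x∈R (Walk-source w) u∉R x~u

EdgeConnected-restrict : ∀ {P R r} → EdgeConnected P → R ⊆ P → r ∈ R →
  (∀ {y z} → y ∈ R → z ∈ P → z ∉ R → Adj y z → Walk R y r) → EdgeConnected R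
EdgeConnected-restrict P-connected R⊆P r∈R exit = rooted⇒EdgeConnected _ λ x∈R →
  Walk-restrict exit x∈R (P-connected (R⊆P x∈R) (R⊆P r∈R))

another-cell : ∀ {P} → Unique P → 2 ≤ length P → ∀ x → ∃ λ z → z ∈ P × z ≢ x
another-cell {_ ∷ []}    _                          (s≤s ()) x
another-cell {u ∷ v ∷ _} ((u≢v ∷ _) AllPairs.∷ _) _        x with u ≟ᶜ x
... | yes refl = v , there (here refl) , u≢v ∘ sym
... | no  u≢x  = u , here refl , u≢x

has-neighbour : ∀ {P x} → Unique P → 2 ≤ length P → EdgeConnected P → x ∈ P → ∃ λ y → y ∈ P × Adj y x
has-neighbour {x = x} P-unique 2≤|P| P-connected x∈P with another-cell P-unique 2≤|P| x
... | z , z∈P , z≢x with P-connected x∈P z∈P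
...   | here _         = ⊥-elim (z≢x refl)
...   | step _ x~y y⇝z = _ , Walk-source y⇝z , Adj-sym x~y

Walk-avoid : ∀ {Q u x a} → Walk Q u x → x ≢ a →
  Walk (Q ∖ [ a ]) u x ⊎ ∃ λ y → Adj a y × Walk (Q ∖ [ a ]) y x
Walk-avoid (here x∈Q) x≢a = inj₁ (here (∈-∖-single⁺ x∈Q x≢a))
Walk-avoid {a = a} (step {x = u} {y = v} u∈Q u~v w) x≢a with Walk-avoid w x≢a
... | inj₂ exit = inj₂ exit
... | inj₁ w′ with u ≟ᶜ a
...   | yes refl = inj₂ (v , u~v , w′)
...   | no  u≢a  = inj₁ (step (∈-∖-single⁺ u∈Q u≢a) u~v w′)

-- Recursion on a bound for length Q: by Walk-avoid, a walk from a to x ≢ a may be taken to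
-- leave a for good towards a neighbour y, inside the shorter list Q ∖ [ a ].
walk? : ∀ Q a x → Dec (Walk Q a x)
walk? Q = bounded (length Q) Q ℕ.≤-refl
  where
  bounded : ∀ n Q → length Q ≤ n → ∀ a x → Dec (Walk Q a x)
  bounded n Q |Q|≤n a x with a ∈? Q | a ≟ᶜ x
  ... | no a∉Q  | _        = no (a∉Q ∘ Walk-source)
  ... | yes a∈Q | yes refl = yes (here a∈Q)
  bounded zero    []      _     a x | yes () | no _
  bounded zero    (_ ∷ _) ()    a x | yes _  | no _
  bounded (suc n) Q       |Q|≤n a x | yes a∈Q | no a≢x
    with any? (λ y → Adj? a y ×-dec bounded n (Q ∖ [ a ]) (ℕ.<⇒≤pred (ℕ.<-≤-trans (length-∖-< a∈Q) |Q|≤n)) y x) Q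
  ... | yes found = yes (let _ , _ , a~y , y⇝x = find found in step a∈Q a~y (Walk-mono ∖-⊆ y⇝x))
  ... | no none   = no λ a⇝x → case Walk-avoid a⇝x (a≢x ∘ sym) of λ where
    (inj₁ a⇝x′)             → proj₂ (∈-∖⁻ {xs = Q} (Walk-source a⇝x′)) (here refl)
    (inj₂ (y , a~y , y⇝x)) → none (lose (∖-⊆ (Walk-source y⇝x)) (a~y , y⇝x))

module Component (L K : List Cell) (b : Cell) where

  reaches? : Decidable (Walk (L ∖ K) b)
  reaches? = walk? (L ∖ K) b

  component rest : List Cell
  component = filter reaches? L
  rest      = filter (∁? reaches?) L

  component⁺ : ∀ {x} → Walk (L ∖ K) b x → x ∈ component
  component⁺ b⇝x = ∈-filter⁺ reaches? (∖-⊆ {xs = L} {ys = K} (Walk-target b⇝x)) b⇝x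

  component⁻ : ∀ {x} → x ∈ component → Walk (L ∖ K) b x
  component⁻ = proj₂ ∘ ∈-filter⁻ reaches? {xs = L}

  component-⊆ : component ⊆ L
  component-⊆ = proj₁ ∘ ∈-filter⁻ reaches? {xs = L}

  rest-⊆ : rest ⊆ L
  rest-⊆ = proj₁ ∘ ∈-filter⁻ (∁? reaches?) {xs = L}

  rest⁺ : ∀ {x} → x ∈ L → x ∉ component → x ∈ rest
  rest⁺ x∈L x∉C = ∈-filter⁺ (∁? reaches?) x∈L (x∉C ∘ component⁺)

  component⇒∉rest : ∀ {x} → x ∈ component → x ∉ rest
  component⇒∉rest x∈C x∈R = proj₂ (∈-filter⁻ (∁? reaches?) {xs = L} x∈R) (component⁻ x∈C)

  root∈component : b ∈ L → b ∉ K → b ∈ component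
  root∈component b∈L b∉K = component⁺ (here (∈-∖⁺ b∈L b∉K))

  component-avoids : ∀ {x} → x ∈ K → x ∉ component
  component-avoids x∈K x∈C = proj₂ (∈-∖⁻ {xs = L} (Walk-target (component⁻ x∈C))) x∈K

  split : ∀ {x} → x ∈ L → x ∈ component ⊎ x ∈ rest
  split {x} x∈L with reaches? x
  ... | yes b⇝x = inj₁ (component⁺ b⇝x)
  ... | no  b↛x = inj₂ (∈-filter⁺ (∁? reaches?) x∈L b↛x)

  length-component+rest : length component + length rest ≡ length L
  length-component+rest = length-filter-∁ reaches? L

  Unique-component : Unique L → Unique component
  Unique-component = Unique.filter⁺ reaches?

  Unique-rest : Unique L → Unique rest
  Unique-rest = Unique.filter⁺ (∁? reaches?)

  component-connected : EdgeConnected component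
  component-connected = rooted⇒EdgeConnected b λ x∈C →
    let b⇝x = component⁻ x∈C in Walk-reverse (inside (here (Walk-source b⇝x)) b⇝x)
    where
    inside : ∀ {u x} → Walk (L ∖ K) b u → Walk (L ∖ K) u x → Walk component u x
    inside b⇝u (here _)         = here (component⁺ b⇝u)
    inside b⇝u (step _ u~v v⇝x) =
      step (component⁺ b⇝u) u~v (inside (Walk-snoc b⇝u u~v (Walk-source v⇝x)) v⇝x)

  rest-boundary : ∀ {y z} → y ∈ rest → z ∈ component → Adj y z → y ∈ K
  rest-boundary {y} y∈R z∈C y~z with y ∈? K
  ... | yes y∈K = y∈K
  ... | no  y∉K = ⊥-elim (component⇒∉rest
          (component⁺ (Walk-snoc (component⁻ z∈C) (Adj-sym y~z) (∈-∖⁺ (rest-⊆ y∈R) y∉K))) y∈R)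

record Symmetry : Set where
  field
    to      : Cell → Cell
    from    : Cell → Cell
    from-to : ∀ x → from (to x) ≡ x
    to-Adj  : ∀ {x y} → Adj x y → Adj (to x) (to y)

open Symmetry

to-injective : (t : Symmetry) → ∀ {x y} → to t x ≡ to t y → x ≡ y
to-injective t {x} {y} tx≡ty = trans (sym (from-to t x)) (trans (cong (from t) tx≡ty) (from-to t y))

infixr 9 _∘ˢ_

_∘ˢ_ : Symmetry → Symmetry → Symmetry
g ∘ˢ f = record
  { to      = to g ∘ to f
  ; from    = from f ∘ from g
  ; from-to = λ x → trans (cong (from f) (from-to g (to f x))) (from-to f x)
  ; to-Adj  = λ x~y → to-Adj g (to-Adj f x~y)
  }

identity : Symmetry
identity = record { to = λ x → x ; from = λ x → x ; from-to = λ _ → refl ; to-Adj = λ x~y → x~y }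

transpose : Symmetry
transpose = record
  { to      = swap
  ; from    = swap
  ; from-to = λ _ → refl
  ; to-Adj  = Sum.swap
  }

∣[a-p]-[c-p]∣≡∣a-c∣ : ∀ a c p → ∣ (a - p) - (c - p) ∣ ≡ ∣ a - c ∣
∣[a-p]-[c-p]∣≡∣a-c∣ a c p = cong ∣_∣ (solve 3 (λ a c p → (a :- p) :- (c :- p) := a :- c) refl a c p)
  where
  open +-*-Solver

∣[-a]-[-c]∣≡∣a-c∣ : ∀ a c → ∣ ℤ.- a - ℤ.- c ∣ ≡ ∣ a - c ∣
∣[-a]-[-c]∣≡∣a-c∣ a c =
  trans (cong ∣_∣ (solve 2 (λ a c → :- a :- :- c := :- (a :- c)) refl a c)) (ℤ.∣-i∣≡∣i∣ (a - c))
  where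
  open +-*-Solver

[a-p]+p≡a : ∀ a p → a - p ℤ.+ p ≡ a
[a-p]+p≡a = solve 2 (λ a p → a :- p :+ p := a) refl
  where
  open +-*-Solver

mirror : Symmetry
mirror = record
  { to      = λ (a , b) → ℤ.- a , b
  ; from    = λ (a , b) → ℤ.- a , b
  ; from-to = λ (a , b) → cong (_, b) (ℤ.neg-involutive a)
  ; to-Adj  = λ
      { {a , b} {c , d} (inj₁ (a≡c , ∣b-d∣≡1)) → inj₁ (cong ℤ.-_ a≡c , ∣b-d∣≡1)
      ; {a , b} {c , d} (inj₂ (b≡d , ∣a-c∣≡1)) → inj₂ (b≡d , trans (∣[-a]-[-c]∣≡∣a-c∣ a c) ∣a-c∣≡1)
      }
  }

translate : Cell → Symmetry
translate (p , q) = record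
  { to      = λ (a , b) → a - p , b - q
  ; from    = λ (a , b) → a ℤ.+ p , b ℤ.+ q
  ; from-to = λ (a , b) → cong₂ _,_ ([a-p]+p≡a a p) ([a-p]+p≡a b q)
  ; to-Adj  = λ
      { {a , b} {c , d} (inj₁ (a≡c , ∣b-d∣≡1)) →
          inj₁ (cong (_- p) a≡c , trans (∣[a-p]-[c-p]∣≡∣a-c∣ b d q) ∣b-d∣≡1)
      ; {a , b} {c , d} (inj₂ (b≡d , ∣a-c∣≡1)) →
          inj₂ (cong (_- q) b≡d , trans (∣[a-p]-[c-p]∣≡∣a-c∣ a c p) ∣a-c∣≡1)
      }
  }

Walk-map : (t : Symmetry) → ∀ {A x y} → Walk A x y → Walk (map (to t) A) (to t x) (to t y)
Walk-map t (here x∈A)       = here (∈-map⁺ (to t) x∈A)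
Walk-map t (step x∈A x~u w) = step (∈-map⁺ (to t) x∈A) (to-Adj t x~u) (Walk-map t w)

EdgeConnected-map : (t : Symmetry) → ∀ {A} → EdgeConnected A → EdgeConnected (map (to t) A)
EdgeConnected-map t A-connected x∈tA y∈tA with ∈-map⁻ (to t) x∈tA | ∈-map⁻ (to t) y∈tA
... | _ , x∈A , refl | _ , y∈A , refl = Walk-map t (A-connected x∈A y∈A)

∉-map : (t : Symmetry) → ∀ {A x} → from t x ∉ A → x ∉ map (to t) A
∉-map t {A} from-x∉A x∈tA with ∈-map⁻ (to t) x∈tA
... | y , y∈A , refl = from-x∉A (subst (_∈ A) (sym (from-to t y)) y∈A)

SameSet-from : (t : Symmetry) → ∀ {A Q} → SameSet (map (to t) A) Q → SameSet A (map (from t) Q)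
SameSet-from t {A} {Q} tA≈Q x = into , back
  where
  into : x ∈ A → x ∈ map (from t) Q
  into x∈A = subst (_∈ map (from t) Q) (from-to t x)
    (∈-map⁺ (from t) (proj₁ (tA≈Q _) (∈-map⁺ (to t) x∈A)))
  back : x ∈ map (from t) Q → x ∈ A
  back x∈fQ with ∈-map⁻ (from t) x∈fQ
  ... | q , q∈Q , refl with ∈-map⁻ (to t) (proj₂ (tA≈Q q) q∈Q)
  ...   | a , a∈A , refl = subst (_∈ A) (sym (from-to t a)) a∈A

Fits : List Cell → ℕ → Symmetry → List Cell → Set
Fits X m t A = Admissible S₀ X m (map (to t) A)

Fits-intro : ∀ {X Z m A c} (t : Symmetry) → Admissible [ c ] Z m A → to t c ≡ origin →
  map (from t) X ⊆ Z → Fits X m t A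
Fits-intro {A = A} t (A-unique , |A|≡m , A-connected , c∈A ∷ [] , Z∉A) tc≡origin X⊆Z =
  Unique.map⁺ (to-injective t) A-unique ,
  trans (List.length-map (to t) A) |A|≡m ,
  EdgeConnected-map t A-connected ,
  subst (_∈ map (to t) A) tc≡origin (∈-map⁺ (to t) c∈A) ∷ [] ,
  All.tabulate (λ x∈X → ∉-map t (All.lookup Z∉A (X⊆Z (∈-map⁺ (from t) x∈X))))

record Covers (b : ℕ) (Pr : List Cell → Set) : Set where
  field
    decode : Fin b → List Cell
    cover  : ∀ {P} → Pr P → ∃ λ c → SameSet P (decode c)

open Covers

Covers⇒≤ : ∀ {S X n k b} → IsCount S X n k → Covers b (Admissible S X n) → k ≤ b
Covers⇒≤ {k = k} {b} (ps , ps-admissible , ps-injective , _) C = Fin.injective⇒≤ code-injective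
  where
  code : Fin k → Fin b
  code i = proj₁ (cover C (ps-admissible i))
  code-injective : ∀ {i j} → code i ≡ code j → i ≡ j
  code-injective {i} {j} code-i≡code-j = ps-injective i j (SameSet-trans
    (proj₂ (cover C (ps-admissible i)))
    (subst (λ c → SameSet (decode C c) (ps j)) (sym code-i≡code-j)
      (SameSet-sym (proj₂ (cover C (ps-admissible j))))))

IsCount⇒Covers : ∀ {S X n k} → IsCount S X n k → Covers k (Admissible S X n)
IsCount⇒Covers (ps , _ , _ , ps-surjective) = record { decode = ps ; cover = ps-surjective _ }

Covers-⊆ : ∀ {b Pr₁ Pr₂} → (∀ {P} → Pr₁ P → Pr₂ P) → Covers b Pr₂ → Covers b Pr₁
Covers-⊆ Pr₁⇒Pr₂ C = record { decode = decode C ; cover = cover C ∘ Pr₁⇒Pr₂ }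

Covers-∪ : ∀ {a b Pr₁ Pr₂} → Covers a Pr₁ → Covers b Pr₂ → Covers (a + b) (λ P → Pr₁ P ⊎ Pr₂ P)
Covers-∪ {a} {b} {Pr₁} {Pr₂} C₁ C₂ = record { decode = decode-∪ ; cover = [ cover₁ , cover₂ ]′ }
  where
  decode-∪ : Fin (a + b) → List Cell
  decode-∪ = [ decode C₁ , decode C₂ ]′ ∘ splitAt a
  cover₁ : ∀ {P} → Pr₁ P → ∃ λ c → SameSet P (decode-∪ c)
  cover₁ p with cover C₁ p
  ... | i , P≈ = i ↑ˡ b ,
    subst (SameSet _) (cong [ decode C₁ , decode C₂ ]′ (sym (Fin.splitAt-↑ˡ a i b))) P≈
  cover₂ : ∀ {P} → Pr₂ P → ∃ λ c → SameSet P (decode-∪ c)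
  cover₂ p with cover C₂ p
  ... | j , P≈ = a ↑ʳ j ,
    subst (SameSet _) (cong [ decode C₁ , decode C₂ ]′ (sym (Fin.splitAt-↑ʳ a b j))) P≈

_⊗_ : (List Cell → Set) → (List Cell → Set) → List Cell → Set
(Pr₁ ⊗ Pr₂) P = ∃₂ λ A B → Pr₁ A × Pr₂ B × SameSet P (A ++ B)

Covers-⊗ : ∀ {a b Pr₁ Pr₂} → Covers a Pr₁ → Covers b Pr₂ → Covers (a * b) (Pr₁ ⊗ Pr₂)
Covers-⊗ {a} {b} {Pr₁} {Pr₂} C₁ C₂ = record { decode = decode-⊗ ; cover = cover-⊗ }
  where
  decode-⊗ : Fin (a * b) → List Cell
  decode-⊗ c = let i , j = remQuot b c in decode C₁ i ++ decode C₂ j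
  cover-⊗ : ∀ {P} → (Pr₁ ⊗ Pr₂) P → ∃ λ c → SameSet P (decode-⊗ c)
  cover-⊗ (A , B , p₁ , p₂ , P≈A++B) with cover C₁ p₁ | cover C₂ p₂
  ... | i , A≈ | j , B≈ = combine i j ,
    subst (λ (i , j) → SameSet _ (decode C₁ i ++ decode C₂ j)) (sym (Fin.remQuot-combine i j))
      (SameSet-trans P≈A++B (SameSet-++ A≈ B≈))

_◃_ : Cell → (List Cell → Set) → List Cell → Set
(x ◃ Pr) P = ∃ λ A → Pr A × SameSet P (x ∷ A)

Covers-◃ : ∀ {b Pr} x → Covers b Pr → Covers b (x ◃ Pr)
Covers-◃ x C = record
  { decode = λ c → x ∷ decode C c
  ; cover  = λ (A , p , P≈x∷A) →
      let c , A≈ = cover C p in c , SameSet-trans P≈x∷A (SameSet-++ SameSet-refl A≈)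
  }

Covers-sum : ∀ {Pr : ℕ → List Cell → Set} (h : ℕ → ℕ) → (∀ k → Covers (h k) (Pr k)) →
  ∀ ks → Covers (sum (map h ks)) (λ P → ∃ λ k → k ∈ ks × Pr k P)
Covers-sum h C []       = record { decode = λ () ; cover = λ { (_ , () , _) } }
Covers-sum {Pr} h C (k ∷ ks) = Covers-⊆ head-or-tail (Covers-∪ (C k) (Covers-sum h C ks))
  where
  head-or-tail : ∀ {P} → (∃ λ k′ → k′ ∈ k ∷ ks × Pr k′ P) → Pr k P ⊎ ∃ λ k′ → k′ ∈ ks × Pr k′ P
  head-or-tail (_ , here refl , p)    = inj₁ p
  head-or-tail (k′ , there k′∈ks , p) = inj₂ (k′ , k′∈ks , p)

Convolution : (ℕ → List Cell → Set) → (ℕ → List Cell → Set) → ℕ → List Cell → Set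
Convolution Pr₁ Pr₂ m P = ∃₂ λ i j → 1 ≤ i × 1 ≤ j × i + j ≡ m × (Pr₁ i ⊗ Pr₂ j) P

Covers-conv : ∀ {f g Pr₁ Pr₂} → (∀ i → Covers (f i) (Pr₁ i)) → (∀ j → Covers (g j) (Pr₂ j)) →
  ∀ m → Covers (conv f g m) (Convolution Pr₁ Pr₂ m)
Covers-conv {Pr₁ = Pr₁} {Pr₂} C₁ C₂ m =
  Covers-⊆ as-sum (Covers-sum _ (λ k → Covers-⊗ (C₁ (suc k)) (C₂ (m ∸ suc k))) (upTo (m ∸ 1)))
  where
  as-sum : ∀ {P} → Convolution Pr₁ Pr₂ m P → ∃ λ k → k ∈ upTo (m ∸ 1) × (Pr₁ (suc k) ⊗ Pr₂ (m ∸ suc k)) P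
  as-sum (suc k , j , _ , 1≤j , refl , pieces) =
    k , ∈-upTo⁺ (ℕ.m<m+n k 1≤j) , subst (λ j → (Pr₁ (suc k) ⊗ Pr₂ j) _) (sym (ℕ.m+n∸m≡n k j)) pieces

Fits-covers : ∀ {X m k} (t : Symmetry) → IsCount S₀ X m k → Covers k (Fits X m t)
Fits-covers {X} {m} {k} t count = record
  { decode = map (from t) ∘ decode C
  ; cover  = λ fits → let c , tA≈ = cover C fits in c , SameSet-from t tA≈
  }
  where
  C : Covers k (Admissible S₀ X m)
  C = IsCount⇒Covers count

forbid : ∀ {S X n P x} → x ∉ P → Admissible S X n P → Admissible S (x ∷ X) n P
forbid x∉P (P-unique , |P|≡n , P-connected , S⊆P , X∉P) =
  P-unique , |P|≡n , P-connected , S⊆P , x∉P ∷ X∉P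

data Corner (P : List Cell) : Set where
  north-only     : north ∈ P → east ∉ P → (∀ {y} → y ∈ P → Adj y origin → y ≡ north) → Corner P
  east-only      : east ∈ P → north ∉ P → (∀ {y} → y ∈ P → Adj y origin → y ≡ east) → Corner P
  north-and-east : north ∈ P → east ∈ P → Corner P

corner : ∀ {Y n P} → Admissible S₀ Y n P → 2 ≤ n → west ∉ P → south ∉ P → Corner P
corner {P = P} (P-unique , refl , P-connected , origin∈P ∷ [] , _) 2≤n west∉P south∉P
  with north ∈? P | east ∈? P
... | yes north∈P | yes east∈P = north-and-east north∈P east∈P
... | yes north∈P | no  east∉P = north-only north∈P east∉P λ y∈P y~origin →
  [ (λ y≡north → y≡north) , (λ { refl → ⊥-elim (east∉P y∈P) }) ]′
    (corner-neighbour west∉P south∉P y∈P y~origin)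
... | no  north∉P | yes east∈P = east-only east∈P north∉P λ y∈P y~origin →
  [ (λ { refl → ⊥-elim (north∉P y∈P) }) , (λ y≡east → y≡east) ]′
    (corner-neighbour west∉P south∉P y∈P y~origin)
... | no  north∉P | no  east∉P with has-neighbour P-unique 2≤n P-connected origin∈P
...   | y , y∈P , y~origin with corner-neighbour west∉P south∉P y∈P y~origin
...     | inj₁ refl = ⊥-elim (north∉P y∈P)
...     | inj₂ refl = ⊥-elim (east∉P y∈P)

remove-leaf : ∀ {Y X m P c} (t : Symmetry) → Admissible S₀ Y (suc m) P → c ∈ P → c ≢ origin →
  (∀ {y} → y ∈ P → Adj y origin → y ≡ c) → to t c ≡ origin → map (from t) X ⊆ Y ++ [ origin ] →
  (origin ◃ Fits X m t) P
remove-leaf {Y = Y} {m = m} {P = P} {c = c} t (P-unique , |P|≡1+m , P-connected , origin∈P ∷ [] , Y∉P)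
    c∈P c≢origin only-c tc≡origin X⊆ =
  A , Fits-intro t A-admissible tc≡origin X⊆ , SameSet-∖-single origin∈P
  where
  A : List Cell
  A = P ∖ [ origin ]
  A⊆P : A ⊆ P
  A⊆P = ∖-⊆
  c∈A : c ∈ A
  c∈A = ∈-∖-single⁺ c∈P c≢origin
  exit : ∀ {y z} → y ∈ A → z ∈ P → z ∉ A → Adj y z → Walk A y c
  exit {y} {z} y∈A z∈P z∉A y~z with z ≟ᶜ origin
  ... | yes refl     = subst (λ y → Walk A y c) (sym (only-c (A⊆P y∈A) y~z)) (here c∈A)
  ... | no  z≢origin = ⊥-elim (z∉A (∈-∖-single⁺ z∈P z≢origin))
  A-admissible : Admissible [ c ] (Y ++ [ origin ]) m A
  A-admissible =
    Unique-∖ P-unique ,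
    ℕ.suc-injective (trans (length-∖-single P-unique origin∈P) |P|≡1+m) ,
    EdgeConnected-restrict P-connected A⊆P c∈A exit ,
    c∈A ∷ [] ,
    ++⁺ (avoid-⊆ A⊆P Y∉P) (∉-∖ {xs = P} (here refl) ∷ [])

split-corner : ∀ {Y XA XB m P} (tA tB : Symmetry) → Admissible S₀ Y (suc m) P →
  west ∉ P → south ∉ P → north ∈ P → east ∈ P → to tA north ≡ origin → to tB east ≡ origin →
  map (from tA) XA ⊆ Y ++ origin ∷ east ∷ northeast ∷ [] →
  map (from tB) XB ⊆ Y ++ origin ∷ north ∷ north² ∷ [] →
  (origin ◃ Convolution (λ i → Fits XA i tA) (λ j → Fits XB j tB) m) P
split-corner {Y = Y} {m = m} {P = P} tA tB (P-unique , |P|≡1+m , P-connected , origin∈P ∷ [] , Y∉P)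
    west∉P south∉P north∈P east∈P tA-north tB-east XA⊆ XB⊆ =
  A ++ B ,
  (length A , length B , ∈-length north∈A , ∈-length east∈B , |A|+|B|≡m , A , B ,
   Fits-intro tA A-admissible tA-north XA⊆ , Fits-intro tB B-admissible tB-east XB⊆ , SameSet-refl) ,
  SameSet-trans (SameSet-∖-single origin∈P) (SameSet-++ SameSet-refl L≈A++B)
  where
  L : List Cell
  L = P ∖ [ origin ]
  open Component L (north ∷ north² ∷ []) east renaming (component to B; rest to A)
  L-unique : Unique L
  L-unique = Unique-∖ P-unique
  L⊆P : L ⊆ P
  L⊆P = ∖-⊆
  origin∉L : origin ∉ L
  origin∉L = ∉-∖ {xs = P} (here refl)
  A⊆P : A ⊆ P
  A⊆P = L⊆P ∘ rest-⊆
  B⊆P : B ⊆ P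
  B⊆P = L⊆P ∘ component-⊆
  north∈A : north ∈ A
  north∈A = rest⁺ (∈-∖-single⁺ north∈P (λ ())) (component-avoids (here refl))
  east∈B : east ∈ B
  east∈B = root∈component (∈-∖-single⁺ east∈P (λ ())) (λ { (here ()) ; (there (here ())) })
  |A|+|B|≡m : length A + length B ≡ m
  |A|+|B|≡m = trans (ℕ.+-comm (length A) (length B))
    (trans length-component+rest (ℕ.suc-injective (trans (length-∖-single P-unique origin∈P) |P|≡1+m)))
  L≈A++B : SameSet L (A ++ B)
  L≈A++B = SameSet-split (Sum.swap ∘ split) rest-⊆ component-⊆
  exit : ∀ {y z} → y ∈ A → z ∈ P → z ∉ A → Adj y z → Walk A y north
  exit {y} {z} y∈A z∈P z∉A y~z with z ≟ᶜ origin
  ... | yes refl = case corner-neighbour west∉P south∉P (A⊆P y∈A) y~z of λ where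
    (inj₁ refl) → here y∈A
    (inj₂ refl) → ⊥-elim (component⇒∉rest east∈B y∈A)
  ... | no z≢origin = case split (∈-∖-single⁺ z∈P z≢origin) of λ where
    (inj₂ z∈A) → ⊥-elim (z∉A z∈A)
    (inj₁ z∈B) → case rest-boundary y∈A z∈B y~z of λ where
      (here refl)         → here y∈A
      (there (here refl)) → step y∈A (inj₁ (refl , refl)) (here north∈A)
  northeast∉A : northeast ∉ A
  northeast∉A northeast∈A with rest-boundary northeast∈A east∈B (inj₁ (refl , refl))
  ... | here ()
  ... | there (here ())
  A-admissible : Admissible [ north ] (Y ++ origin ∷ east ∷ northeast ∷ []) (length A) A
  A-admissible =
    Unique-rest L-unique , refl , EdgeConnected-restrict P-connected A⊆P north∈A exit , north∈A ∷ [] ,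
    ++⁺ (avoid-⊆ A⊆P Y∉P) (origin∉L ∘ rest-⊆ ∷ component⇒∉rest east∈B ∷ northeast∉A ∷ [])
  B-admissible : Admissible [ east ] (Y ++ origin ∷ north ∷ north² ∷ []) (length B) B
  B-admissible =
    Unique-component L-unique , refl , component-connected , east∈B ∷ [] ,
    ++⁺ (avoid-⊆ B⊆P Y∉P)
      (origin∉L ∘ component-⊆ ∷ component-avoids (here refl) ∷ component-avoids (there (here refl)) ∷ [])

split-west : ∀ {Y XA XB n P} (tA tB : Symmetry) → Admissible S₀ Y n P → west ∈ P →
  to tA west ≡ origin → to tB origin ≡ origin →
  map (from tA) XA ⊆ Y ++ origin ∷ north ∷ [] →
  map (from tB) XB ⊆ Y ++ west ∷ northwest ∷ [] →
  Convolution (λ i → Fits XA i tA) (λ j → Fits XB j tB) n P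
split-west {Y = Y} {P = P} tA tB (P-unique , refl , P-connected , origin∈P ∷ [] , Y∉P)
    west∈P tA-west tB-origin XA⊆ XB⊆ =
  length A , length B , ∈-length west∈A , ∈-length origin∈B , length-component+rest , A , B ,
  Fits-intro tA A-admissible tA-west XA⊆ , Fits-intro tB B-admissible tB-origin XB⊆ ,
  SameSet-split split component-⊆ rest-⊆
  where
  open Component P (origin ∷ north ∷ []) west renaming (component to A; rest to B)
  west∈A : west ∈ A
  west∈A = root∈component west∈P (λ { (here ()) ; (there (here ())) })
  origin∈B : origin ∈ B
  origin∈B = rest⁺ origin∈P (component-avoids (here refl))
  exit : ∀ {y z} → y ∈ B → z ∈ P → z ∉ B → Adj y z → Walk B y origin
  exit y∈B z∈P z∉B y~z = case split z∈P of λ where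
    (inj₂ z∈B) → ⊥-elim (z∉B z∈B)
    (inj₁ z∈A) → case rest-boundary y∈B z∈A y~z of λ where
      (here refl)         → here y∈B
      (there (here refl)) → step y∈B (inj₁ (refl , refl)) (here origin∈B)
  northwest∉B : northwest ∉ B
  northwest∉B northwest∈B with rest-boundary northwest∈B west∈A (inj₁ (refl , refl))
  ... | here ()
  ... | there (here ())
  A-admissible : Admissible [ west ] (Y ++ origin ∷ north ∷ []) (length A) A
  A-admissible =
    Unique-component P-unique , refl , component-connected , west∈A ∷ [] ,
    ++⁺ (avoid-⊆ component-⊆ Y∉P)
      (component-avoids (here refl) ∷ component-avoids (there (here refl)) ∷ [])
  B-admissible : Admissible [ origin ] (Y ++ west ∷ northwest ∷ []) (length B) B
  B-admissible =
    Unique-rest P-unique , refl , EdgeConnected-restrict P-connected rest-⊆ origin∈B exit ,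
    origin∈B ∷ [] ,
    ++⁺ (avoid-⊆ rest-⊆ Y∉P) (component⇒∉rest west∈A ∷ northwest∉B ∷ [])

Counts : List Cell → (ℕ → ℕ) → Set
Counts X C = ∀ n → IsCount S₀ X n (C n)

E-bound : ∀ {E F} → Counts X-E E → Counts X-F F → ∀ {n} → 2 ≤ n → E n ≤ F (n ∸ 1)
E-bound hE hF {suc m} 2≤n =
  Covers⇒≤ (hE (suc m)) (Covers-⊆ decompose (Covers-◃ origin (Fits-covers (translate north) (hF m))))
  where
  decompose : ∀ {P} → Admissible S₀ X-E (suc m) P → (origin ◃ Fits X-F m (translate north)) P
  decompose adm@(_ , _ , _ , _ , west∉P ∷ east∉P ∷ _ ∷ south∉P ∷ _) with corner adm 2≤n west∉P south∉P
  ... | north-only north∈P _ only-north =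
    remove-leaf (translate north) adm north∈P (λ ()) only-north refl (decide-⊆ _)
  ... | east-only east∈P _ _       = ⊥-elim (east∉P east∈P)
  ... | north-and-east _ east∈P    = ⊥-elim (east∉P east∈P)

F-bound : ∀ {F G H} → Counts X-F F → Counts X-G G → Counts X-H H → ∀ n → F n ≤ G n + conv G H n
F-bound hF hG hH n = Covers⇒≤ (hF n) (Covers-⊆ decompose (Covers-∪ (IsCount⇒Covers (hG n))
  (Covers-conv (λ i → Fits-covers turn (hG i)) (λ j → Fits-covers identity (hH j)) n)))
  where
  turn : Symmetry
  turn = transpose ∘ˢ mirror ∘ˢ translate west
  decompose : ∀ {P} → Admissible S₀ X-F n P →
    Admissible S₀ X-G n P ⊎ Convolution (λ i → Fits X-G i turn) (λ j → Fits X-H j identity) n P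
  decompose {P} adm with west ∈? P
  ... | no  west∉P = inj₁ (forbid west∉P adm)
  ... | yes west∈P = inj₂ (split-west turn identity adm west∈P refl refl (decide-⊆ _) (decide-⊆ _))

corner-bound : ∀ {Y X₁ X₂ XA XB C C₁ C₂ CA CB} (t₁ t₂ tA tB : Symmetry) →
  Counts Y C → Counts X₁ C₁ → Counts X₂ C₂ → Counts XA CA → Counts XB CB →
  west ∈ Y → south ∈ Y →
  to t₁ north ≡ origin → to t₂ east ≡ origin → to tA north ≡ origin → to tB east ≡ origin →
  map (from t₁) X₁ ⊆ (east ∷ Y) ++ [ origin ] →
  map (from t₂) X₂ ⊆ (north ∷ Y) ++ [ origin ] →
  map (from tA) XA ⊆ Y ++ origin ∷ east ∷ northeast ∷ [] →
  map (from tB) XB ⊆ Y ++ origin ∷ north ∷ north² ∷ [] →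
  ∀ {n} → 2 ≤ n → C n ≤ C₁ (n ∸ 1) + C₂ (n ∸ 1) + conv CA CB (n ∸ 1)
corner-bound {Y} {X₁} {X₂} {XA} {XB} t₁ t₂ tA tB count count₁ count₂ countA countB west∈Y south∈Y
             t₁-north t₂-east tA-north tB-east X₁⊆ X₂⊆ XA⊆ XB⊆ {suc m} 2≤n =
  Covers⇒≤ (count (suc m)) (Covers-⊆ decompose (Covers-∪
    (Covers-∪ (Covers-◃ origin (Fits-covers t₁ (count₁ m)))
              (Covers-◃ origin (Fits-covers t₂ (count₂ m))))
    (Covers-◃ origin (Covers-conv (λ i → Fits-covers tA (countA i))
                                  (λ j → Fits-covers tB (countB j)) m))))
  where
  decompose : ∀ {P} → Admissible S₀ Y (suc m) P →
    ((origin ◃ Fits X₁ m t₁) P ⊎ (origin ◃ Fits X₂ m t₂) P) ⊎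
    (origin ◃ Convolution (λ i → Fits XA i tA) (λ j → Fits XB j tB) m) P
  decompose adm@(_ , _ , _ , _ , Y∉P)
    with corner adm 2≤n (All.lookup Y∉P west∈Y) (All.lookup Y∉P south∈Y)
  ... | north-only north∈P east∉P only-north =
    inj₁ (inj₁ (remove-leaf t₁ (forbid east∉P adm) north∈P (λ ()) only-north t₁-north X₁⊆))
  ... | east-only east∈P north∉P only-east =
    inj₁ (inj₂ (remove-leaf t₂ (forbid north∉P adm) east∈P (λ ()) only-east t₂-east X₂⊆))
  ... | north-and-east north∈P east∈P =
    inj₂ (split-corner tA tB adm (All.lookup Y∉P west∈Y) (All.lookup Y∉P south∈Y) north∈P east∈P
            tA-north tB-east XA⊆ XB⊆)

G-bound : ∀ {F G L} → Counts X-F F → Counts X-G G → Counts X-L L →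
  ∀ {n} → 2 ≤ n → G n ≤ F (n ∸ 1) + G (n ∸ 1) + conv G L (n ∸ 1)
G-bound hF hG hL = corner-bound
  (translate north) (transpose ∘ˢ translate east) (mirror ∘ˢ translate north) (transpose ∘ˢ translate east)
  hG hF hG hG hL (here refl) (there (there (here refl))) refl refl refl refl
  (decide-⊆ _) (decide-⊆ _) (decide-⊆ _) (decide-⊆ _)

H-bound : ∀ {E G H L} → Counts X-E E → Counts X-G G → Counts X-H H → Counts X-L L →
  ∀ {n} → 2 ≤ n → H n ≤ 2 * G (n ∸ 1) + conv E L (n ∸ 1)
H-bound {E} {G} {H} {L} hE hG hH hL {n} 2≤n =
  subst (λ k → H n ≤ k + conv E L (n ∸ 1)) (cong (G (n ∸ 1) +_) (sym (ℕ.+-identityʳ (G (n ∸ 1)))))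
  (corner-bound
    (translate north) (transpose ∘ˢ translate east) (translate north) (transpose ∘ˢ translate east)
    hH hG hG hE hL (there (here refl)) (there (there (there (here refl)))) refl refl refl refl
    (decide-⊆ _) (decide-⊆ _) (decide-⊆ _) (decide-⊆ _) 2≤n)

L-bound : ∀ {F G H L M} → Counts X-F F → Counts X-G G → Counts X-H H → Counts X-L L → Counts X-M M →
  ∀ {n} → 2 ≤ n → L n ≤ F (n ∸ 1) + H (n ∸ 1) + conv G M (n ∸ 1)
L-bound hF hG hH hL hM = corner-bound
  (translate north) (translate east) (mirror ∘ˢ translate north) (transpose ∘ˢ translate east)
  hL hF hH hG hM (here refl) (there (there (here refl))) refl refl refl refl
  (decide-⊆ _) (decide-⊆ _) (decide-⊆ _) (decide-⊆ _)

M-bound : ∀ {E G H M} → Counts X-E E → Counts X-G G → Counts X-H H → Counts X-M M →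
  ∀ {n} → 2 ≤ n → M n ≤ G (n ∸ 1) + H (n ∸ 1) + conv E M (n ∸ 1)
M-bound hE hG hH hM = corner-bound
  (translate north) (translate east) (translate north) (transpose ∘ˢ translate east)
  hM hG hH hE hM (there (here refl)) (there (there (there (here refl)))) refl refl refl refl
  (decide-⊆ _) (decide-⊆ _) (decide-⊆ _) (decide-⊆ _)

lemma1 : (E F G H L M : ℕ → ℕ) →
    (∀ n → IsCount S₀ X-E n (E n)) →
    (∀ n → IsCount S₀ X-F n (F n)) →
    (∀ n → IsCount S₀ X-G n (G n)) →
    (∀ n → IsCount S₀ X-H n (H n)) →
    (∀ n → IsCount S₀ X-L n (L n)) →
    (∀ n → IsCount S₀ X-M n (M n)) →
    ∀ n → 2 ≤ n →
      (E n ≤ F (n ∸ 1)) ×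
      (F n ≤ G n + conv G H n) ×
      (G n ≤ F (n ∸ 1) + G (n ∸ 1) + conv G L (n ∸ 1)) ×
      (H n ≤ 2 * G (n ∸ 1) + conv E L (n ∸ 1)) ×
      (L n ≤ F (n ∸ 1) + H (n ∸ 1) + conv G M (n ∸ 1)) ×
      (M n ≤ G (n ∸ 1) + H (n ∸ 1) + conv E M (n ∸ 1))
lemma1 E F G H L M hE hF hG hH hL hM n 2≤n =
  E-bound hE hF 2≤n ,
  F-bound hF hG hH n ,
  G-bound hF hG hL 2≤n ,
  H-bound hE hG hH hL 2≤n ,
  L-bound hF hG hH hL hM 2≤n ,
  M-bound hE hG hH hM 2≤n
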